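{- Let $r\geqslant 0$ and $n\geqslant 2$ be integers with $n\geqslant 2r$. Then there exists $\pi\in\mathrm{Sym}_n$ with $w_H(\pi)=2r$ such that $$I(n,2r,r)=|B_r(\pi)\cap B_r(I_n)|=\sum_{i=0}^{r}|\{\sigma\in\mathrm{Sym}_n: w_H(\sigma)=i,\ d(\sigma,\pi)\leqslant r\}|.$$ Moreover, for this $\pi$, every $\sigma\in B_r(\pi)\cap B_r(I_n)$ satisfies $Tc(\sigma)\subset Tc(\pi)$ and $|Tc(\sigma)|=r$.
   Context: $\mathrm{Sym}_n$ is the symmetric group on $[n]=\{1,\dots,n\}$, $I_n$ its identity, $d(\pi,\tau)=|\{i\in[n]:\pi(i)\neq\tau(i)\}|$ the Hamming distance, $w_H(\pi)=d(I_n,\pi)$, $B_r(\pi)=\{\sigma\in\mathrm{Sym}_n:d(\pi,\sigma)\leqslant r\}$, and $I(n,d,r)=\max\{|B_r(\pi)\cap B_r(\tau)| : \pi,\tau\in\mathrm{Sym}_n,\ d(\pi,\tau)=d\}$. For $\pi\in\mathrm{Sym}_n$, $Tc(\pi)=\{(i,\pi(i)) : i\in[n],\ \pi(i)\neq i\}$. -}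

module Defs where

open import Data.Nat using (ℕ; zero; suc; _+_; _*_; _≤_; _≤?_; _⊔_)
open import Data.Fin using (Fin; _≟_)
open import Data.Vec using (Vec; []; _∷_; lookup; toList)
open import Data.List using (List; []; _∷_; [_]; map; concatMap; filter; allFin; length; foldr; cartesianProduct; upTo)
open import Data.Nat.ListAction using (sum)
open import Data.Product using (_×_; _,_; proj₁; proj₂)
open import Relation.Nullary using (¬?; _×-dec_)
open import Relation.Binary.PropositionalEquality using (_≡_)
import Data.List.Relation.Unary.Unique.DecPropositional as UDP

-- A permutation of [n] = Fin n is represented in one-line notation as a
-- vector v of length n (v(i) = lookup v i) whose entries are pairwise distinct
-- (an injective self-map of a finite set, i.e. a bijection).
IsPerm : {n : ℕ} → Vec (Fin n) n → Set
IsPerm {n} v = UDP.Unique (_≟_ {n}) (toList v)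

isPerm? : {n : ℕ} → (v : Vec (Fin n) n) → _
isPerm? {n} v = UDP.unique? (_≟_ {n}) (toList v)

allVecs : (n k : ℕ) → List (Vec (Fin n) k)
allVecs n zero = [ [] ]
allVecs n (suc k) = concatMap (λ x → map (x ∷_) (allVecs n k)) (allFin n)

Sym : (n : ℕ) → List (Vec (Fin n) n)
Sym n = filter isPerm? (allVecs n n)

idPerm : (n : ℕ) → Vec (Fin n) n
idPerm n = Data.Vec.tabulate (λ i → i)
  where import Data.Vec

dist : {n : ℕ} → Vec (Fin n) n → Vec (Fin n) n → ℕ
dist {n} π τ = length (filter (λ i → ¬? (lookup π i ≟ lookup τ i)) (allFin n))

wH : {n : ℕ} → Vec (Fin n) n → ℕ
wH {n} π = dist (idPerm n) π

ballInter : {n : ℕ} → ℕ → Vec (Fin n) n → Vec (Fin n) n → ℕ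
ballInter {n} r π τ =
  length (filter (λ σ → (dist π σ ≤? r) ×-dec (dist τ σ ≤? r)) (Sym n))

Imax : (n d r : ℕ) → ℕ
Imax n d r =
  foldr _⊔_ 0
    (map (λ p → ballInter r (proj₁ p) (proj₂ p))
      (filter (λ p → dist (proj₁ p) (proj₂ p) Data.Nat.≟ d)
        (cartesianProduct (Sym n) (Sym n))))
  where import Data.Nat

countWt : {n : ℕ} → ℕ → ℕ → Vec (Fin n) n → ℕ
countWt {n} i r π =
  length (filter (λ σ → (wH σ Data.Nat.≟ i) ×-dec (dist σ π ≤? r)) (Sym n))
  where import Data.Nat

sumTo : ℕ → (ℕ → ℕ) → ℕ
sumTo r f = sum (map f (upTo (suc r)))

Tc : {n : ℕ} → Vec (Fin n) n → List (Fin n × Fin n)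
Tc {n} π = map (λ i → i , lookup π i)
             (filter (λ i → ¬? (lookup π i ≟ i)) (allFin n))

-- Left multiplication by a permutation p is a Hamming isometry that permutes Sym_n, so
-- |B_r(π₁) ∩ B_r(π₂)| = |B_r(π₂⁻¹π₁) ∩ B_r(I_n)| and w_H(π₂⁻¹π₁) = d(π₁, π₂). The maximum defining
-- I(n, 2r, r) is over a nonempty set (a product of r disjoint transpositions has weight 2r), hence
-- attained at some pair, which translates to a pair (π, I_n); grouping B_r(I_n) by Hamming weight
-- gives the sum. For σ in both balls, summing over the positions i the inequality
--   [π(i) ≠ i] + [σ(i) ≠ i and σ(i) ≠ π(i)] ≤ [σ(i) ≠ i] + [σ(i) ≠ π(i)]
-- gives 2r + #{i : σ(i) ∉ {i, π(i)}} ≤ d(I_n, σ) + d(π, σ) ≤ 2r, so σ moves exactly r points,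
-- each of them to where π sends it.

module Submission where

open import Defs
open import Data.Nat using (ℕ; _*_; _≤_)
open import Data.Fin using (Fin)
open import Data.Vec using (Vec)
open import Data.List using (length)
open import Data.List.Membership.Propositional using (_∈_)
open import Data.Product using (Σ; _×_)
open import Relation.Binary.PropositionalEquality using (_≡_)

open import Level using (Level)
open import Function using (_∘_; id)
open import Function.Definitions using (Injective)
open import Function.Bundles using (mk⇔)
open import Data.Bool.Base using (if_then_else_)
open import Data.Empty using (⊥-elim)
open import Data.Sum using (_⊎_; inj₁; inj₂)
open import Data.Product using (∃; _,_; proj₁; proj₂)
open import Data.Nat as ℕ using (zero; suc; _+_; _⊔_; _≤?_; z≤n; s≤s; s≤s⁻¹)
open import Data.Nat.Properties hiding (_≟_)
open import Data.Nat.ListAction using (sum)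
open import Data.Nat.ListAction.Properties using (sum-++)
open import Algebra.Properties.CommutativeSemigroup +-commutativeSemigroup using (interchange)
open import Data.Fin as Fin using (_≟_)
import Data.Fin.Properties as Finₚ
open import Data.Vec using ([]; _∷_; lookup; toList; tabulate)
open import Data.Vec.Properties
  using (lookup∘tabulate; tabulate∘lookup; tabulate-cong; ∷-injectiveˡ; ∷-injectiveʳ)
import Data.Vec.Relation.Unary.All.Properties as VecAllₚ
import Data.List as List
open import Data.List using (List; []; _∷_; [_]; _++_; map; filter; allFin; foldr; cartesianProduct; upTo)
open import Data.List.Properties
  using (filter-≐; filter-some; filter-none; length-map; map-++; map-tabulate; applyUpTo-∷ʳ)
open import Data.List.Relation.Unary.Any as Any using (here; there)
import Data.List.Relation.Unary.All as All
import Data.List.Relation.Unary.All.Properties as Allₚ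
import Data.List.Relation.Unary.AllPairs as AllPairs
open import Data.List.Relation.Unary.AllPairs using ([]; _∷_)
import Data.List.Relation.Unary.AllPairs.Properties as AllPairsₚ
open import Data.List.Relation.Unary.Unique.Propositional using (Unique)
import Data.List.Relation.Unary.Unique.Propositional.Properties as Uniqueₚ
open import Data.List.Membership.Propositional.Properties
  using ( ∈-map⁺; ∈-map⁻; ∈-concatMap⁺; ∈-allFin; ∈-filter⁺; ∈-filter⁻
        ; ∈-cartesianProduct⁺; ∈-cartesianProduct⁻)
open import Data.List.Membership.Propositional.Properties.WithK using (unique∧set⇒bag)
open import Data.List.Relation.Binary.BagAndSetEquality using (∼bag⇒↭)
open import Data.List.Relation.Binary.Permutation.Propositional using (_↭_)
open import Data.List.Relation.Binary.Permutation.Propositional.Properties using (filter-↭; ↭-length)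
open import Relation.Nullary using (¬_; Dec; yes; no; does; ¬?; _×-dec_)
open import Relation.Nullary.Decidable using (decidable-stable)
open import Relation.Unary using (Pred; Decidable; _≐_)
open import Relation.Unary.Properties using (_∪?_; _∩?_)
open import Relation.Binary.PropositionalEquality
  using (refl; sym; trans; cong; cong₂; subst; _≢_; module ≡-Reasoning)

private
  variable
    a ℓ : Level
    A B : Set a
    k m n : ℕ

indicator : {P : Set ℓ} → Dec P → ℕ
indicator P? = if does P? then 1 else 0

count : {P : Pred A ℓ} → Decidable P → List A → ℕ
count P? xs = length (filter P? xs)

module _ {P : Pred A ℓ} (P? : Decidable P) where

  count-∷ : ∀ x xs → count P? (x ∷ xs) ≡ indicator (P? x) + count P? xs
  count-∷ x xs with P? x
  ... | yes _ = refl
  ... | no _  = refl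

  count-map : (f : B → A) (xs : List B) → count P? (map f xs) ≡ count (P? ∘ f) xs
  count-map f []       = refl
  count-map f (x ∷ xs) with P? (f x)
  ... | yes _ = cong suc (count-map f xs)
  ... | no _  = count-map f xs

  count-↭-map : {f : A → A} {xs : List A} → xs ↭ map f xs → count P? xs ≡ count (P? ∘ f) xs
  count-↭-map {f} {xs} xs↭fxs = trans (↭-length (filter-↭ P? xs↭fxs)) (count-map f xs)

  count≡0⇒¬ : ∀ {x xs} → count P? xs ≡ 0 → x ∈ xs → ¬ P x
  count≡0⇒¬ count≡0 x∈xs Px =
    n≮0 (subst (0 ℕ.<_) count≡0 (filter-some P? (Any.map (λ { refl → Px }) x∈xs)))

count-≐ : {P Q : Pred A ℓ} (P? : Decidable P) (Q? : Decidable Q) → P ≐ Q →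
          ∀ xs → count P? xs ≡ count Q? xs
count-≐ P? Q? P≐Q xs = cong length (filter-≐ P? Q? P≐Q xs)

count-allFin-suc : {P : Pred (Fin (suc n)) ℓ} (P? : Decidable P) →
                   count P? (allFin (suc n)) ≡ indicator (P? Fin.zero) + count (P? ∘ Fin.suc) (allFin n)
count-allFin-suc {n = n} P? = begin
  count P? (allFin (suc n))
    ≡⟨ count-∷ P? Fin.zero (List.tabulate Fin.suc) ⟩
  indicator (P? Fin.zero) + count P? (List.tabulate Fin.suc)
    ≡⟨ cong (λ xs → indicator (P? Fin.zero) + count P? xs) (sym (map-tabulate id Fin.suc)) ⟩
  indicator (P? Fin.zero) + count P? (map Fin.suc (allFin n))
    ≡⟨ cong (indicator (P? Fin.zero) +_) (count-map P? Fin.suc (allFin n)) ⟩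
  indicator (P? Fin.zero) + count (P? ∘ Fin.suc) (allFin n) ∎
  where open ≡-Reasoning

module _ {P Q R S : Pred A ℓ}
         (P? : Decidable P) (Q? : Decidable Q) (R? : Decidable R) (S? : Decidable S) where

  count-+-mono : (∀ x → indicator (P? x) + indicator (Q? x) ≤ indicator (R? x) + indicator (S? x)) →
                 ∀ xs → count P? xs + count Q? xs ≤ count R? xs + count S? xs
  count-+-mono pointwise []       = z≤n
  count-+-mono pointwise (x ∷ xs) = begin
    count P? (x ∷ xs) + count Q? (x ∷ xs)
      ≡⟨ cong₂ _+_ (count-∷ P? x xs) (count-∷ Q? x xs) ⟩
    (indicator (P? x) + count P? xs) + (indicator (Q? x) + count Q? xs)
      ≡⟨ interchange (indicator (P? x)) (count P? xs) (indicator (Q? x)) (count Q? xs) ⟩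
    (indicator (P? x) + indicator (Q? x)) + (count P? xs + count Q? xs)
      ≤⟨ +-mono-≤ (pointwise x) (count-+-mono pointwise xs) ⟩
    (indicator (R? x) + indicator (S? x)) + (count R? xs + count S? xs)
      ≡⟨ interchange (indicator (R? x)) (indicator (S? x)) (count R? xs) (count S? xs) ⟩
    (indicator (R? x) + count R? xs) + (indicator (S? x) + count S? xs)
      ≡⟨ sym (cong₂ _+_ (count-∷ R? x xs) (count-∷ S? x xs)) ⟩
    count R? (x ∷ xs) + count S? (x ∷ xs) ∎
    where open ≤-Reasoning

module _ {P Q : Pred A ℓ} (P? : Decidable P) (Q? : Decidable Q) where

  count-∪-∩ : ∀ xs → count (P? ∪? Q?) xs + count (P? ∩? Q?) xs ≡ count P? xs + count Q? xs
  count-∪-∩ xs = ≤-antisym (count-+-mono _ _ P? Q? (≤-reflexive ∘ by-cases) xs)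
                           (count-+-mono P? Q? _ _ (≤-reflexive ∘ sym ∘ by-cases) xs)
    where
    by-cases : ∀ x → indicator ((P? ∪? Q?) x) + indicator ((P? ∩? Q?) x)
                   ≡ indicator (P? x) + indicator (Q? x)
    by-cases x with P? x | Q? x
    ... | yes _ | yes _ = refl
    ... | yes _ | no _  = refl
    ... | no _  | yes _ = refl
    ... | no _  | no _  = refl

  count-disjoint-∪ : (∀ x → ¬ (P x × Q x)) → ∀ xs → count (P? ∪? Q?) xs ≡ count P? xs + count Q? xs
  count-disjoint-∪ disjoint xs = begin
    count (P? ∪? Q?) xs
      ≡⟨ sym (+-identityʳ _) ⟩
    count (P? ∪? Q?) xs + 0
      ≡⟨ cong (λ ys → count (P? ∪? Q?) xs + length ys)
              (sym (filter-none (P? ∩? Q?) (All.universal disjoint xs))) ⟩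
    count (P? ∪? Q?) xs + count (P? ∩? Q?) xs
      ≡⟨ count-∪-∩ xs ⟩
    count P? xs + count Q? xs ∎
    where open ≡-Reasoning

sumTo-suc : ∀ k f → sumTo (suc k) f ≡ sumTo k f + f (suc k)
sumTo-suc k f = begin
  sum (map f (upTo (suc (suc k))))            ≡⟨ cong (sum ∘ map f) (sym (applyUpTo-∷ʳ id (suc k))) ⟩
  sum (map f (upTo (suc k) ++ [ suc k ]))     ≡⟨ cong sum (map-++ f (upTo (suc k)) [ suc k ]) ⟩
  sum (map f (upTo (suc k)) ++ [ f (suc k) ]) ≡⟨ sum-++ (map f (upTo (suc k))) [ f (suc k) ] ⟩
  sumTo k f + (f (suc k) + 0)                 ≡⟨ cong (sumTo k f +_) (+-identityʳ (f (suc k))) ⟩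
  sumTo k f + f (suc k)                       ∎
  where open ≡-Reasoning

module _ (w : A → ℕ) {P : Pred A ℓ} (P? : Decidable P) where

  count-weight≤ : ∀ k xs → count (λ x → (w x ≤? k) ×-dec P? x) xs
                         ≡ sumTo k (λ i → count (λ x → (w x ℕ.≟ i) ×-dec P? x) xs)
  count-weight≤ zero xs =
    trans (count-≐ _ _ ((λ (w≤0 , Px) → n≤0⇒n≡0 w≤0 , Px) , (λ (w≡0 , Px) → ≤-reflexive w≡0 , Px))
                   xs)
          (sym (+-identityʳ _))
  count-weight≤ (suc k) xs = begin
    count (λ x → (w x ≤? suc k) ×-dec P? x) xs
      ≡⟨ count-≐ _ (weight≤ k ∪? weight≡ (suc k)) (split , merge) xs ⟩
    count (weight≤ k ∪? weight≡ (suc k)) xs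
      ≡⟨ count-disjoint-∪ (weight≤ k) (weight≡ (suc k)) disjoint xs ⟩
    count (weight≤ k) xs + count (weight≡ (suc k)) xs
      ≡⟨ cong (_+ count (weight≡ (suc k)) xs) (count-weight≤ k xs) ⟩
    sumTo k (λ i → count (weight≡ i) xs) + count (weight≡ (suc k)) xs
      ≡⟨ sym (sumTo-suc k (λ i → count (weight≡ i) xs)) ⟩
    sumTo (suc k) (λ i → count (weight≡ i) xs) ∎
    where
    open ≡-Reasoning
    weight≤ : (j : ℕ) → Decidable (λ x → w x ≤ j × P x)
    weight≤ j x = (w x ≤? j) ×-dec P? x
    weight≡ : (j : ℕ) → Decidable (λ x → w x ≡ j × P x)
    weight≡ j x = (w x ℕ.≟ j) ×-dec P? x
    split : ∀ {x} → w x ≤ suc k × P x → (w x ≤ k × P x) ⊎ (w x ≡ suc k × P x)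
    split (w≤1+k , Px) with m≤n⇒m<n∨m≡n w≤1+k
    ... | inj₁ w<1+k = inj₁ (s≤s⁻¹ w<1+k , Px)
    ... | inj₂ w≡1+k = inj₂ (w≡1+k , Px)
    merge : ∀ {x} → (w x ≤ k × P x) ⊎ (w x ≡ suc k × P x) → w x ≤ suc k × P x
    merge (inj₁ (w≤k , Px))   = m≤n⇒m≤1+n w≤k , Px
    merge (inj₂ (w≡1+k , Px)) = ≤-reflexive w≡1+k , Px
    disjoint : ∀ x → ¬ ((w x ≤ k × P x) × (w x ≡ suc k × P x))
    disjoint _ ((w≤k , _) , (w≡1+k , _)) = 1+n≰n (subst (_≤ k) w≡1+k w≤k)

foldr-⊔-∈ : ∀ {x} {xs : List ℕ} → x ∈ xs → foldr _⊔_ 0 xs ∈ xs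
foldr-⊔-∈ {xs = y ∷ ys} _ = nonempty y ys
  where
  nonempty : ∀ y ys → foldr _⊔_ 0 (y ∷ ys) ∈ y ∷ ys
  nonempty y []       = here (⊔-identityʳ y)
  nonempty y (z ∷ zs) with ⊔-sel y (foldr _⊔_ 0 (z ∷ zs))
  ... | inj₁ y⊔m≡y = here y⊔m≡y
  ... | inj₂ y⊔m≡m = there (subst (_∈ z ∷ zs) (sym y⊔m≡m) (nonempty z zs))

lookup-ext : {u v : Vec A k} → (∀ i → lookup u i ≡ lookup v i) → u ≡ v
lookup-ext {u = u} {v} u≗v =
  trans (sym (tabulate∘lookup u)) (trans (tabulate-cong u≗v) (tabulate∘lookup v))

unique⇒lookup-injective : (v : Vec A k) → Unique (toList v) → Injective _≡_ _≡_ (lookup v)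
unique⇒lookup-injective (x ∷ v) (x∉v ∷ v!) {Fin.zero}  {Fin.zero}  _ = refl
unique⇒lookup-injective (x ∷ v) (x∉v ∷ v!) {Fin.zero}  {Fin.suc j} e =
  ⊥-elim (VecAllₚ.lookup⁺ (VecAllₚ.toList⁻ x∉v) j e)
unique⇒lookup-injective (x ∷ v) (x∉v ∷ v!) {Fin.suc i} {Fin.zero}  e =
  ⊥-elim (VecAllₚ.lookup⁺ (VecAllₚ.toList⁻ x∉v) i (sym e))
unique⇒lookup-injective (x ∷ v) (x∉v ∷ v!) {Fin.suc i} {Fin.suc j} e =
  cong Fin.suc (unique⇒lookup-injective v v! e)

lookup-injective⇒unique : (v : Vec A k) → Injective _≡_ _≡_ (lookup v) → Unique (toList v)
lookup-injective⇒unique []      _   = []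
lookup-injective⇒unique (x ∷ v) inj =
  VecAllₚ.toList⁺ (VecAllₚ.lookup⁻ (λ j x≡vj → Finₚ.0≢1+n (inj x≡vj)))
  ∷ lookup-injective⇒unique v (Finₚ.suc-injective ∘ inj)

endo-injective⇒surjective : {f : Fin n → Fin n} → Injective _≡_ _≡_ f → ∀ y → ∃ λ x → f x ≡ y
endo-injective⇒surjective {n} {f} f-inj y with Finₚ.any? (λ x → f x ≟ y)
... | yes hit = hit
... | no miss = ⊥-elim (1+n≰n (Finₚ.injective⇒≤ extended-injective))
  where
  extended : Fin (suc n) → Fin n
  extended Fin.zero    = y
  extended (Fin.suc x) = f x
  extended-injective : Injective _≡_ _≡_ extended
  extended-injective {Fin.zero}  {Fin.zero}  _ = refl
  extended-injective {Fin.zero}  {Fin.suc x} e = ⊥-elim (miss (x , sym e))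
  extended-injective {Fin.suc x} {Fin.zero}  e = ⊥-elim (miss (x , e))
  extended-injective {Fin.suc x} {Fin.suc z} e = cong Fin.suc (f-inj e)

infixr 9 _∘ᵥ_

_∘ᵥ_ : Vec A m → Vec (Fin m) k → Vec A k
p ∘ᵥ q = tabulate (lookup p ∘ lookup q)

lookup-∘ᵥ : (p : Vec A m) (q : Vec (Fin m) k) (i : Fin k) → lookup (p ∘ᵥ q) i ≡ lookup p (lookup q i)
lookup-∘ᵥ p q = lookup∘tabulate (lookup p ∘ lookup q)

lookup-idPerm : (i : Fin n) → lookup (idPerm n) i ≡ i
lookup-idPerm = lookup∘tabulate id

∘ᵥ-identityʳ : (p : Vec A n) → p ∘ᵥ idPerm n ≡ p
∘ᵥ-identityʳ {n = n} p =
  lookup-ext λ i → trans (lookup-∘ᵥ p (idPerm n) i) (cong (lookup p) (lookup-idPerm i))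

∘ᵥ-injectiveˡ : {p : Vec A m} {σ τ : Vec (Fin m) k} → Injective _≡_ _≡_ (lookup p) →
                p ∘ᵥ σ ≡ p ∘ᵥ τ → σ ≡ τ
∘ᵥ-injectiveˡ {p = p} {σ} {τ} p-inj pσ≡pτ = lookup-ext λ i → p-inj (begin
  lookup p (lookup σ i) ≡⟨ sym (lookup-∘ᵥ p σ i) ⟩
  lookup (p ∘ᵥ σ) i     ≡⟨ cong (λ v → lookup v i) pσ≡pτ ⟩
  lookup (p ∘ᵥ τ) i     ≡⟨ lookup-∘ᵥ p τ i ⟩
  lookup p (lookup τ i) ∎)
  where open ≡-Reasoning

idPerm-isPerm : IsPerm (idPerm n)
idPerm-isPerm {n} = lookup-injective⇒unique (idPerm n) λ {i} {j} e →
  trans (sym (lookup-idPerm i)) (trans e (lookup-idPerm j))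

∘ᵥ-isPerm : {p q : Vec (Fin n) n} → IsPerm p → IsPerm q → IsPerm (p ∘ᵥ q)
∘ᵥ-isPerm {p = p} {q} p-perm q-perm = lookup-injective⇒unique (p ∘ᵥ q) λ {i} {j} e →
  unique⇒lookup-injective q q-perm (unique⇒lookup-injective p p-perm
    (trans (sym (lookup-∘ᵥ p q i)) (trans e (lookup-∘ᵥ p q j))))

module _ {p : Vec (Fin n) n} (p-perm : IsPerm p) where

  private
    preimage : ∀ y → ∃ λ x → lookup p x ≡ y
    preimage = endo-injective⇒surjective (unique⇒lookup-injective p p-perm)

  inverse : Vec (Fin n) n
  inverse = tabulate (proj₁ ∘ preimage)

  lookup-inverse : ∀ y → lookup p (lookup inverse y) ≡ y
  lookup-inverse y = trans (cong (lookup p) (lookup∘tabulate _ y)) (proj₂ (preimage y))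

  inverse-isPerm : IsPerm inverse
  inverse-isPerm = lookup-injective⇒unique inverse λ {x} {y} e →
    trans (sym (lookup-inverse x)) (trans (cong (lookup p) e) (lookup-inverse y))

  ∘ᵥ-inverseʳ : (q : Vec (Fin n) n) → p ∘ᵥ inverse ∘ᵥ q ≡ q
  ∘ᵥ-inverseʳ q = lookup-ext λ i →
    trans (lookup-∘ᵥ p (inverse ∘ᵥ q) i)
          (trans (cong (lookup p) (lookup-∘ᵥ inverse q i)) (lookup-inverse (lookup q i)))

∈-allVecs : ∀ n k (v : Vec (Fin n) k) → v ∈ allVecs n k
∈-allVecs n zero    []      = here refl
∈-allVecs n (suc k) (x ∷ v) =
  ∈-concatMap⁺ (λ y → map (y ∷_) (allVecs n k))
               (Any.map (λ { refl → ∈-map⁺ (x ∷_) (∈-allVecs n k v) }) (∈-allFin x))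

allVecs-unique : ∀ n k → Unique (allVecs n k)
allVecs-unique n zero    = All.[] ∷ []
allVecs-unique n (suc k) =
  Uniqueₚ.concat⁺
    (Allₚ.map⁺ (All.universal (λ _ → Uniqueₚ.map⁺ ∷-injectiveʳ (allVecs-unique n k)) (allFin n)))
    (AllPairsₚ.map⁺ (AllPairs.map different-heads (Uniqueₚ.allFin⁺ n)))
  where
  different-heads : ∀ {x y} → x ≢ y →
                    ∀ {v} → ¬ (v ∈ map (x ∷_) (allVecs n k) × v ∈ map (y ∷_) (allVecs n k))
  different-heads x≢y (v∈xL , v∈yL) with ∈-map⁻ (_ ∷_) v∈xL | ∈-map⁻ (_ ∷_) v∈yL
  ... | _ , _ , refl | _ , _ , x∷u≡y∷w = x≢y (∷-injectiveˡ x∷u≡y∷w)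

∈-Sym : {v : Vec (Fin n) n} → IsPerm v → v ∈ Sym n
∈-Sym {n} {v} v-perm = ∈-filter⁺ isPerm? (∈-allVecs n n v) v-perm

Sym-isPerm : {v : Vec (Fin n) n} → v ∈ Sym n → IsPerm v
Sym-isPerm {n} v∈Sym = proj₂ (∈-filter⁻ isPerm? {xs = allVecs n n} v∈Sym)

Sym-unique : ∀ n → Unique (Sym n)
Sym-unique n = Uniqueₚ.filter⁺ isPerm? (allVecs-unique n n)

bijective-map-↭ : {xs : List A} {f : A → A} → Unique xs → Injective _≡_ _≡_ f →
                  (∀ {x} → x ∈ xs → f x ∈ xs) →
                  (∀ {y} → y ∈ xs → ∃ λ x → x ∈ xs × f x ≡ y) →
                  xs ↭ map f xs
bijective-map-↭ {f = f} xs! f-inj f-closed f-onto =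
  ∼bag⇒↭ (unique∧set⇒bag xs! (Uniqueₚ.map⁺ f-inj xs!) (mk⇔ into outof))
  where
  into : ∀ {y} → y ∈ _ → y ∈ map f _
  into y∈xs with f-onto y∈xs
  ... | x , x∈xs , refl = ∈-map⁺ f x∈xs
  outof : ∀ {y} → y ∈ map f _ → y ∈ _
  outof y∈fxs with ∈-map⁻ f y∈fxs
  ... | x , x∈xs , refl = f-closed x∈xs

Sym-↭-∘ᵥˡ : {p : Vec (Fin n) n} → IsPerm p → Sym n ↭ map (p ∘ᵥ_) (Sym n)
Sym-↭-∘ᵥˡ {n} {p} p-perm =
  bijective-map-↭ (Sym-unique n) (∘ᵥ-injectiveˡ {p = p} (unique⇒lookup-injective p p-perm))
    (λ σ∈Sym → ∈-Sym (∘ᵥ-isPerm p-perm (Sym-isPerm σ∈Sym)))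
    (λ {σ} σ∈Sym → inverse p-perm ∘ᵥ σ
                 , ∈-Sym (∘ᵥ-isPerm (inverse-isPerm p-perm) (Sym-isPerm σ∈Sym))
                 , ∘ᵥ-inverseʳ p-perm σ)

dist-cong : (a b c d : Vec (Fin n) n) →
            (∀ i → lookup a i ≡ lookup b i → lookup c i ≡ lookup d i) →
            (∀ i → lookup c i ≡ lookup d i → lookup a i ≡ lookup b i) → dist a b ≡ dist c d
dist-cong {n} a b c d ab⇒cd cd⇒ab =
  count-≐ _ _ ((λ {i} a≢b c≡d → a≢b (cd⇒ab i c≡d)) , (λ {i} c≢d a≡b → c≢d (ab⇒cd i a≡b)))
              (allFin n)

dist-sym : (a b : Vec (Fin n) n) → dist a b ≡ dist b a
dist-sym a b = dist-cong a b b a (λ _ → sym) (λ _ → sym)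

dist-∘ᵥˡ : {p : Vec (Fin n) n} → Injective _≡_ _≡_ (lookup p) →
           (σ τ : Vec (Fin n) n) → dist (p ∘ᵥ σ) (p ∘ᵥ τ) ≡ dist σ τ
dist-∘ᵥˡ {p = p} p-inj σ τ = dist-cong (p ∘ᵥ σ) (p ∘ᵥ τ) σ τ
  (λ i e → p-inj (trans (sym (lookup-∘ᵥ p σ i)) (trans e (lookup-∘ᵥ p τ i))))
  (λ i e → trans (lookup-∘ᵥ p σ i) (trans (cong (lookup p) e) (sym (lookup-∘ᵥ p τ i))))

ballInter-∘ᵥˡ : ∀ r {p : Vec (Fin n) n} → IsPerm p →
                (π τ : Vec (Fin n) n) → ballInter r (p ∘ᵥ π) (p ∘ᵥ τ) ≡ ballInter r π τ
ballInter-∘ᵥˡ {n} r {p} p-perm π τ =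
  trans (count-↭-map _ (Sym-↭-∘ᵥˡ p-perm))
        (count-≐ _ _ ( (λ {σ} (≤π , ≤τ) → within (d π σ) ≤π , within (d τ σ) ≤τ)
                     , (λ {σ} (≤π , ≤τ) → within (sym (d π σ)) ≤π , within (sym (d τ σ)) ≤τ))
                 (Sym n))
  where
  d : ∀ ρ σ → dist (p ∘ᵥ ρ) (p ∘ᵥ σ) ≡ dist ρ σ
  d = dist-∘ᵥˡ {p = p} (unique⇒lookup-injective p p-perm)
  within : ∀ {x y} → x ≡ y → x ≤ r → y ≤ r
  within = subst (_≤ r)

module _ {p : Vec (Fin n) n} (p-perm : IsPerm p) (q : Vec (Fin n) n) where

  wH-inverse-∘ᵥ : wH (inverse p-perm ∘ᵥ q) ≡ dist q p
  wH-inverse-∘ᵥ = begin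
    dist (idPerm n) (inverse p-perm ∘ᵥ q)
      ≡⟨ sym (dist-∘ᵥˡ {p = p} (unique⇒lookup-injective p p-perm) (idPerm n) (inverse p-perm ∘ᵥ q)) ⟩
    dist (p ∘ᵥ idPerm n) (p ∘ᵥ inverse p-perm ∘ᵥ q)
      ≡⟨ cong₂ dist (∘ᵥ-identityʳ p) (∘ᵥ-inverseʳ p-perm q) ⟩
    dist p q
      ≡⟨ dist-sym p q ⟩
    dist q p ∎
    where open ≡-Reasoning

  ballInter-inverse-∘ᵥ : ∀ r → ballInter r q p ≡ ballInter r (inverse p-perm ∘ᵥ q) (idPerm n)
  ballInter-inverse-∘ᵥ r = begin
    ballInter r q p
      ≡⟨ sym (cong₂ (ballInter r) (∘ᵥ-inverseʳ p-perm q) (∘ᵥ-identityʳ p)) ⟩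
    ballInter r (p ∘ᵥ inverse p-perm ∘ᵥ q) (p ∘ᵥ idPerm n)
      ≡⟨ ballInter-∘ᵥˡ r p-perm (inverse p-perm ∘ᵥ q) (idPerm n) ⟩
    ballInter r (inverse p-perm ∘ᵥ q) (idPerm n) ∎
    where open ≡-Reasoning

max-attained : (f : A → ℕ) {x : A} {xs : List A} → x ∈ xs →
               ∃ λ y → y ∈ xs × foldr _⊔_ 0 (map f xs) ≡ f y
max-attained f x∈xs = ∈-map⁻ f (foldr-⊔-∈ (∈-map⁺ f x∈xs))

Imax-attained : ∀ d r {τ₁ τ₂ : Vec (Fin n) n} → IsPerm τ₁ → IsPerm τ₂ → dist τ₁ τ₂ ≡ d →
                Σ (Vec (Fin n) n × Vec (Fin n) n) λ (p₁ , p₂) →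
                  IsPerm p₁ × IsPerm p₂ × dist p₁ p₂ ≡ d × Imax n d r ≡ ballInter r p₁ p₂
Imax-attained {n} d r τ₁-perm τ₂-perm τ₁τ₂≡d
  with (p₁ , p₂) , pair∈ , Imax≡ ← max-attained (λ (p₁ , p₂) → ballInter r p₁ p₂)
         (∈-filter⁺ (λ (p₁ , p₂) → dist p₁ p₂ ℕ.≟ d)
                    (∈-cartesianProduct⁺ (∈-Sym τ₁-perm) (∈-Sym τ₂-perm)) τ₁τ₂≡d)
  with pair∈Sym² , p₁p₂≡d ← ∈-filter⁻ _ {xs = cartesianProduct (Sym n) (Sym n)} pair∈
  with p₁∈Sym , p₂∈Sym ← ∈-cartesianProduct⁻ (Sym n) (Sym n) pair∈Sym²
  = (p₁ , p₂) , Sym-isPerm p₁∈Sym , Sym-isPerm p₂∈Sym , p₁p₂≡d , Imax≡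

ballInter-by-weight : ∀ r (π : Vec (Fin n) n) →
                      ballInter r π (idPerm n) ≡ sumTo r (λ i → countWt i r π)
ballInter-by-weight {n} r π =
  trans (count-≐ _ _ ( (λ {σ} (≤π , ≤id) → ≤id , subst (_≤ r) (dist-sym π σ) ≤π)
                     , (λ {σ} (≤id , ≤π) → subst (_≤ r) (dist-sym σ π) ≤π , ≤id))
                 (Sym n))
        (count-weight≤ wH (λ σ → dist σ π ≤? r) r (Sym n))

hamming-midpoint : ∀ r (τ π σ : Vec (Fin n) n) →
                   2 * r ≤ dist τ π → dist τ σ ≤ r → dist π σ ≤ r →
                   dist τ σ ≡ r × (∀ i → lookup τ i ≢ lookup σ i → lookup π i ≡ lookup σ i)
hamming-midpoint {n} r τ π σ 2r≤τπ τσ≤r πσ≤r = ≤-antisym τσ≤r r≤τσ , agree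
  where
  leaves-both : Decidable λ i → lookup τ i ≢ lookup σ i × lookup π i ≢ lookup σ i
  leaves-both i = ¬? (lookup τ i ≟ lookup σ i) ×-dec ¬? (lookup π i ≟ lookup σ i)

  triangle : dist τ π + count leaves-both (allFin n) ≤ dist τ σ + dist π σ
  triangle = count-+-mono _ leaves-both _ _ by-cases (allFin n)
    where
    by-cases : ∀ i → indicator (¬? (lookup τ i ≟ lookup π i)) + indicator (leaves-both i)
                   ≤ indicator (¬? (lookup τ i ≟ lookup σ i)) + indicator (¬? (lookup π i ≟ lookup σ i))
    by-cases i with lookup τ i ≟ lookup σ i | lookup π i ≟ lookup σ i | lookup τ i ≟ lookup π i
    ... | yes τ≡σ | yes π≡σ | no τ≢π = ⊥-elim (τ≢π (trans τ≡σ (sym π≡σ)))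
    ... | yes _   | yes _   | yes _  = ≤-refl
    ... | yes _   | no _    | yes _  = z≤n
    ... | yes _   | no _    | no _   = ≤-refl
    ... | no _    | yes _   | yes _  = z≤n
    ... | no _    | yes _   | no _   = ≤-refl
    ... | no _    | no _    | yes _  = s≤s z≤n
    ... | no _    | no _    | no _   = ≤-refl

  2r+leaves≤τσ+πσ : 2 * r + count leaves-both (allFin n) ≤ dist τ σ + dist π σ
  2r+leaves≤τσ+πσ = ≤-trans (+-monoˡ-≤ _ 2r≤τπ) triangle

  r+r≡2r : r + r ≡ 2 * r
  r+r≡2r = cong (r +_) (sym (+-identityʳ r))

  no-leaves : count leaves-both (allFin n) ≡ 0
  no-leaves = n≤0⇒n≡0 (+-cancelˡ-≤ (2 * r) _ 0 (begin
    2 * r + count leaves-both (allFin n)   ≤⟨ 2r+leaves≤τσ+πσ ⟩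
    dist τ σ + dist π σ                    ≤⟨ +-mono-≤ τσ≤r πσ≤r ⟩
    r + r                                  ≡⟨ trans r+r≡2r (sym (+-identityʳ _)) ⟩
    2 * r + 0                              ∎))
    where open ≤-Reasoning

  r≤τσ : r ≤ dist τ σ
  r≤τσ = +-cancelʳ-≤ r r (dist τ σ) (begin
    r + r                                  ≡⟨ r+r≡2r ⟩
    2 * r                                  ≤⟨ m≤m+n _ _ ⟩
    2 * r + count leaves-both (allFin n)   ≤⟨ 2r+leaves≤τσ+πσ ⟩
    dist τ σ + dist π σ                    ≤⟨ +-monoʳ-≤ (dist τ σ) πσ≤r ⟩
    dist τ σ + r                           ∎)
    where open ≤-Reasoning

  agree : ∀ i → lookup τ i ≢ lookup σ i → lookup π i ≡ lookup σ i
  agree i τ≢σ = decidable-stable (lookup π i ≟ lookup σ i) λ π≢σ →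
    count≡0⇒¬ leaves-both no-leaves (∈-allFin i) (τ≢σ , π≢σ)

Tc-⊆ : (σ π : Vec (Fin n) n) → (∀ i → lookup σ i ≢ i → lookup π i ≡ lookup σ i) →
       ∀ x → x ∈ Tc σ → x ∈ Tc π
Tc-⊆ {n} σ π agree x x∈Tcσ with ∈-map⁻ (λ i → i , lookup σ i) x∈Tcσ
... | i , i∈moved , refl with ∈-filter⁻ (λ i → ¬? (lookup σ i ≟ i)) {xs = allFin n} i∈moved
... | _ , σi≢i = subst (λ y → (i , y) ∈ Tc π) (agree i σi≢i)
  (∈-map⁺ (λ i → i , lookup π i)
    (∈-filter⁺ (λ i → ¬? (lookup π i ≟ i)) (∈-allFin i)
      (λ πi≡i → σi≢i (trans (sym (agree i σi≢i)) πi≡i))))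

length-Tc : (σ : Vec (Fin n) n) → length (Tc σ) ≡ wH σ
length-Tc {n} σ = trans (length-map _ (filter (λ i → ¬? (lookup σ i ≟ i)) (allFin n)))
  (count-≐ _ _ ((λ {i} σi≢i i≡σi → σi≢i (trans (sym i≡σi) (lookup-idPerm i))) ,
                (λ {i} i≢σi σi≡i → i≢σi (trans (lookup-idPerm i) (sym σi≡i)))) (allFin n))

Tc-midpoint : ∀ r (π σ : Vec (Fin n) n) → wH π ≡ 2 * r → dist π σ ≤ r → dist (idPerm n) σ ≤ r →
              ((x : Fin n × Fin n) → x ∈ Tc σ → x ∈ Tc π) × length (Tc σ) ≡ r
Tc-midpoint {n} r π σ wHπ≡2r πσ≤r idσ≤r
  with idσ≡r , agree ← hamming-midpoint r (idPerm n) π σ (≤-reflexive (sym wHπ≡2r)) idσ≤r πσ≤r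
  = Tc-⊆ σ π (λ i σi≢i → agree i (λ i≡σi → σi≢i (trans (sym i≡σi) (lookup-idPerm i))))
  , trans (length-Tc σ) idσ≡r

-- The product of transpositions (0 1)(2 3)⋯(2r−2 2r−1), cut short if fewer than 2r points exist.
swaps : ℕ → (n : ℕ) → Fin n → Fin n
swaps zero    n             i                     = i
swaps (suc r) (suc zero)    i                     = i
swaps (suc r) (suc (suc n)) Fin.zero              = Fin.suc Fin.zero
swaps (suc r) (suc (suc n)) (Fin.suc Fin.zero)    = Fin.zero
swaps (suc r) (suc (suc n)) (Fin.suc (Fin.suc i)) = Fin.suc (Fin.suc (swaps r n i))

swaps-involutive : ∀ r n (i : Fin n) → swaps r n (swaps r n i) ≡ i
swaps-involutive zero    n             i                     = refl
swaps-involutive (suc r) (suc zero)    i                     = refl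
swaps-involutive (suc r) (suc (suc n)) Fin.zero              = refl
swaps-involutive (suc r) (suc (suc n)) (Fin.suc Fin.zero)    = refl
swaps-involutive (suc r) (suc (suc n)) (Fin.suc (Fin.suc i)) =
  cong (Fin.suc ∘ Fin.suc) (swaps-involutive r n i)

swaps-moved : ∀ r n → 2 * r ≤ n → count (λ i → ¬? (i ≟ swaps r n i)) (allFin n) ≡ 2 * r
swaps-moved zero    n             _    =
  cong length (filter-none _ (All.universal (λ _ i≢i → i≢i refl) (allFin n)))
swaps-moved (suc r) zero          ()
swaps-moved (suc r) (suc zero)    2r≤1 =
  ⊥-elim (1+n≰n (≤-trans (m≤m+n 2 (2 * r)) (subst (_≤ 1) (*-suc 2 r) 2r≤1)))
swaps-moved (suc r) (suc (suc n)) 2r≤n = begin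
  count moved (allFin (suc (suc n)))
    ≡⟨ count-allFin-suc moved ⟩
  1 + count (moved ∘ Fin.suc) (allFin (suc n))
    ≡⟨ cong suc (count-allFin-suc (moved ∘ Fin.suc)) ⟩
  2 + count (moved ∘ Fin.suc ∘ Fin.suc) (allFin n)
    ≡⟨ cong (2 +_) (count-≐ _ _ (shift , unshift) (allFin n)) ⟩
  2 + count (λ i → ¬? (i ≟ swaps r n i)) (allFin n)
    ≡⟨ cong (2 +_) (swaps-moved r n (+-cancelˡ-≤ 2 _ _ (subst (_≤ 2 + n) (*-suc 2 r) 2r≤n))) ⟩
  2 + 2 * r
    ≡⟨ sym (*-suc 2 r) ⟩
  2 * suc r ∎
  where
  open ≡-Reasoning
  moved : Decidable λ i → i ≢ swaps (suc r) (suc (suc n)) i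
  moved i = ¬? (i ≟ swaps (suc r) (suc (suc n)) i)
  shift : ∀ {i} → Fin.suc (Fin.suc i) ≢ Fin.suc (Fin.suc (swaps r n i)) → i ≢ swaps r n i
  shift ne eq = ne (cong (Fin.suc ∘ Fin.suc) eq)
  unshift : ∀ {i} → i ≢ swaps r n i → Fin.suc (Fin.suc i) ≢ Fin.suc (Fin.suc (swaps r n i))
  unshift ne eq = ne (Finₚ.suc-injective (Finₚ.suc-injective eq))

swaps-isPerm : ∀ r n → IsPerm (tabulate (swaps r n))
swaps-isPerm r n = lookup-injective⇒unique (tabulate (swaps r n)) λ {i} {j} e → begin
  i                         ≡⟨ sym (swaps-involutive r n i) ⟩
  swaps r n (swaps r n i)   ≡⟨ cong (swaps r n) (trans (sym (lookup∘tabulate _ i))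
                                                      (trans e (lookup∘tabulate _ j))) ⟩
  swaps r n (swaps r n j)   ≡⟨ swaps-involutive r n j ⟩
  j                         ∎
  where open ≡-Reasoning

wH-swaps : ∀ r n → 2 * r ≤ n → wH (tabulate (swaps r n)) ≡ 2 * r
wH-swaps r n 2r≤n = trans
  (count-≐ _ _ ( (λ {i} ne eq → ne (trans (lookup-idPerm i) (trans eq (sym (lookup∘tabulate _ i)))))
               , (λ {i} ne eq → ne (trans (sym (lookup-idPerm i)) (trans eq (lookup∘tabulate _ i)))))
               (allFin n))
  (swaps-moved r n 2r≤n)

lemma8 : (r n : ℕ) → 2 ≤ n → 2 * r ≤ n →
    Σ (Vec (Fin n) n) (λ π →
      IsPerm π × wH π ≡ 2 * r
      × Imax n (2 * r) r ≡ ballInter r π (idPerm n)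
      × ballInter r π (idPerm n) ≡ sumTo r (λ i → countWt i r π)
      × ((σ : Vec (Fin n) n) → IsPerm σ →
           dist π σ ≤ r → dist (idPerm n) σ ≤ r →
           ((x : Fin n × Fin n) → x ∈ Tc σ → x ∈ Tc π)
           × length (Tc σ) ≡ r))
lemma8 r n _ 2r≤n
  with (p₁ , p₂) , p₁-perm , p₂-perm , p₁p₂≡2r , Imax≡ ←
         Imax-attained (2 * r) r idPerm-isPerm (swaps-isPerm r n) (wH-swaps r n 2r≤n)
  = π , ∘ᵥ-isPerm (inverse-isPerm p₂-perm) p₁-perm , wHπ≡2r
  , trans Imax≡ (ballInter-inverse-∘ᵥ p₂-perm p₁ r)
  , ballInter-by-weight r π
  , λ σ _ → Tc-midpoint r π σ wHπ≡2r
  where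
  π : Vec (Fin n) n
  π = inverse p₂-perm ∘ᵥ p₁
  wHπ≡2r : wH π ≡ 2 * r
  wHπ≡2r = trans (wH-inverse-∘ᵥ p₂-perm p₁) p₁p₂≡2r
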